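{- Let $r$ be a positive integer, $s$ a nonnegative integer, $k\in\mathbb Z$, $a_1,\dots,a_r$ nonzero complex numbers, and $\lambda\in\mathbb C$ with $\lambda\ne1$. Then for every integer $n\ge0$, $$S_n^{(r,k)}(x|a_1,\dots,a_r)=\sum_{m=0}^n\left(\frac{\binom{n}{m}}{(1-\lambda)^s}\sum_{j=0}^s\binom{s}{j}(-\lambda)^{s-j}S_{n-m}^{(r,k)}(j|a_1,\dots,a_r)\right)H_m^{(s)}(x|\lambda).$$
   Context: For an integer $k$, ${\rm Li}_k(x)=\sum_{m=1}^\infty x^m/m^k$. For $r\in\mathbb Z_{>0}$, $k\in\mathbb Z$ and nonzero complex $a_1,\dots,a_r$, the polynomials $S_n^{(r,k)}(x|a_1,\dots,a_r)$ are defined by $\frac{t^r}{\prod_{j=1}^r(e^{a_jt}-1)}\frac{{\rm Li}_k(1-e^{ -t})}{1-e^{ -t}}e^{xt}=\sum_{n\ge0}S_n^{(r,k)}(x|a_1,\dots,a_r)\frac{t^n}{n!}$. For $\lambda\ne1$, the Frobenius–Euler polynomials of order $s$ are defined by $\left(\frac{1-\lambda}{e^t-\lambda}\right)^se^{xt}=\sum_{n\ge0}H_n^{(s)}(x|\lambda)\frac{t^n}{n!}$. -}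

module Defs where

open import Level using (Level; _⊔_) renaming (suc to lsuc)
open import Algebra.Bundles using (CommutativeRing)
open import Data.Nat as ℕ using (ℕ; zero; suc)
open import Data.Nat.Combinatorics using (_C_)
open import Data.Integer using (ℤ; +_; -[1+_])
open import Data.Fin using (Fin)
import Data.Fin as Fin
open import Relation.Nullary using (¬_)

-- A field of characteristic zero: a commutative ring together with
-- multiplicative inverses of nonzero elements, in which n·1 ≠ 0 for n ≥ 1.
-- (The complex numbers are the intended instance.)
-- n · 1 in a commutative ring
ofℕR : {c ℓ : Level} (R : CommutativeRing c ℓ) → ℕ → CommutativeRing.Carrier R
ofℕR R zero    = CommutativeRing.0# R
ofℕR R (suc n) = CommutativeRing._+_ R (CommutativeRing.1# R) (ofℕR R n)

record CharZeroField (c ℓ : Level) : Set (lsuc (c ⊔ ℓ)) where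
  field
    cring : CommutativeRing c ℓ
  open CommutativeRing cring public

  ofℕ : ℕ → Carrier
  ofℕ = ofℕR cring

  field
    inv      : (x : Carrier) → ¬ (x ≈ 0#) → Carrier
    inv-left : (x : Carrier) (p : ¬ (x ≈ 0#)) → inv x p * x ≈ 1#
    charZero : (n : ℕ) → ¬ (ofℕR cring (suc n) ≈ 0#)

module _ {c ℓ : Level} (F : CharZeroField c ℓ) where
  open CharZeroField F

  oneMinusNZ : (lam : Carrier) → ¬ (lam ≈ 1#) → ¬ ((1# - lam) ≈ 0#)
  oneMinusNZ lam h p = h (sym (x∙y⁻¹≈ε⇒x≈y 1# lam p))
    where open import Algebra.Properties.Group +-group using (x∙y⁻¹≈ε⇒x≈y)

  pow : Carrier → ℕ → Carrier
  pow x zero    = 1#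
  pow x (suc n) = x * pow x n

  -- 1/n in F (junk value 0 at n = 0, never used below)
  recip : ℕ → Carrier
  recip zero    = 0#
  recip (suc n) = inv (ofℕ (suc n)) (charZero n)

  invFact : ℕ → Carrier
  invFact n = recip (n ℕ.!)

  sumTo : ℕ → (ℕ → Carrier) → Carrier
  sumTo zero    f = f 0
  sumTo (suc n) f = sumTo n f + f (suc n)

  -- Formal power series in t over F, given by coefficient sequences
  -- (f n is the coefficient of t^n).
  FPS : Set c
  FPS = ℕ → Carrier

  oneS : FPS
  oneS zero    = 1#
  oneS (suc n) = 0#

  constS : Carrier → FPS
  constS a zero    = a
  constS a (suc n) = 0#

  _⊕_ : FPS → FPS → FPS
  (f ⊕ g) n = f n + g n

  _⊖_ : FPS → FPS → FPS
  (f ⊖ g) n = f n - g n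

  scaleS : Carrier → FPS → FPS
  scaleS a f n = a * f n

  _⊛_ : FPS → FPS → FPS
  (f ⊛ g) n = sumTo n (λ i → f i * g (n ℕ.∸ i))

  powS : FPS → ℕ → FPS
  powS f zero    = oneS
  powS f (suc m) = f ⊛ powS f m

  -- Given c with c * f 0 ≈ 1, the multiplicative inverse of f:
  -- writing c·f = 1 - h (so h 0 ≈ 0), 1/f = c · Σ_m h^m, and the
  -- coefficient of t^n only involves m ≤ n.
  invSWith : Carrier → FPS → FPS
  invSWith c f n = c * sumTo n (λ m → powS h m n)
    where
    h : FPS
    h = oneS ⊖ scaleS c f

  expS : Carrier → FPS
  expS a n = pow a n * invFact n

  -- (e^{a t} - 1)/t
  expm1OverT : Carrier → FPS
  expm1OverT a n = pow a (suc n) * invFact (suc n)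

  uS : FPS
  uS = oneS ⊖ expS (- 1#)

  invPowZ : ℕ → ℤ → Carrier
  invPowZ m (+ k)     = recip (m ℕ.^ k)
  invPowZ m -[1+ k ]  = pow (ofℕ m) (suc k)

  -- Li_k(u)/u = Σ_{m ≥ 1} u^{m-1}/m^k, composed with u = 1 - e^{-t}
  -- (u has zero constant term, so only m - 1 ≤ n contribute to t^n).
  LiOverS : ℤ → FPS
  LiOverS k n = sumTo n (λ m → invPowZ (suc m) k * powS uS m n)

  -- t^r / Π_{j} (e^{a_j t} - 1) = Π_j ((e^{a_j t} - 1)/t)^{-1}
  prodInv : (r : ℕ) (a : Fin r → Carrier) → (∀ i → ¬ (a i ≈ 0#)) → FPS
  prodInv zero    a nz = oneS
  prodInv (suc r) a nz =
    invSWith (inv (a Fin.zero) (nz Fin.zero)) (expm1OverT (a Fin.zero))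
      ⊛ prodInv r (λ i → a (Fin.suc i)) (λ i → nz (Fin.suc i))

  S : (r : ℕ) → ℤ → (a : Fin r → Carrier) → (∀ i → ¬ (a i ≈ 0#)) →
      ℕ → Carrier → Carrier
  S r k a nz n x =
    ofℕ (n ℕ.!) * ((prodInv r a nz ⊛ LiOverS k) ⊛ expS x) n

  H : (s : ℕ) (lam : Carrier) → ¬ (lam ≈ 1#) → ℕ → Carrier → Carrier
  H s lam ne1 n x =
    ofℕ (n ℕ.!) * (powS base s ⊛ expS x) n
    where
    base : FPS
    base = scaleS (1# - lam)
             (invSWith (inv (1# - lam) (oneMinusNZ lam ne1)) (expS 1# ⊖ constS lam))

{-# OPTIONS --safe #-}
-- The generating function of H^{(s)}(x|λ) is K(t) e^{xt} with the kernel
-- K = ((1-λ)/(e^t-λ))^s, whose inverse K⁻¹ = (e^t-λ)^s/(1-λ)^s expands by the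
-- binomial theorem and e^{at} e^{bt} = e^{(a+b)t} into (1-λ)^{-s} Σ_j C(s,j)(-λ)^{s-j} e^{jt}.
-- Hence the generating function G(t) e^{xt} of S_n^{(r,k)}(x) factors as
--   G(t) e^{xt} = (K(t) e^{xt}) · (G(t) K⁻¹(t)),
-- and comparing coefficients of t^n/n! (a binomial convolution) gives the identity,
-- the coefficients of G K⁻¹ being the displayed combinations of S_{n-m}^{(r,k)}(j).
module Submission where

open import Defs
open import Level using (Level)
open import Data.Nat as ℕ using (ℕ; zero; suc; _≤_; _<_; _∸_; z≤n; s≤s; _!; NonZero)
import Data.Nat.Properties as ℕP
open import Data.Nat.Combinatorics using (_C_; nCk≡n!/k![n-k]!; k![n∸k]!∣n!)
open import Data.Nat.DivMod using (m/n*n≡m)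
open import Data.Integer using (ℤ)
open import Data.Fin using (Fin; toℕ)
import Data.Fin as Fin
open import Data.Product using (_,_)
open import Data.Sum using (inj₁; inj₂)
open import Relation.Binary.PropositionalEquality as ≡ using (_≡_)
open import Relation.Binary.Structures using (IsEquivalence)
open import Relation.Nullary using (¬_)
open import Algebra.Bundles using (CommutativeSemiring)
import Algebra.Properties.CommutativeSemiring.Binomial as Binomial
import Algebra.Solver.Ring.NaturalCoefficients.Default as RingSolver

module FormalPowerSeries {c ℓ : Level} (F : CharZeroField c ℓ) where
  open CharZeroField F
  open import Relation.Binary.Reasoning.Setoid setoid
  open RingSolver commutativeSemiring using (solve; _:+_; _:*_; _:=_)
  open import Algebra.Properties.Ring ring using (-0#≈0#)
  open import Algebra.Definitions.RawMonoid +-rawMonoid using (sum; _×_)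
  open import Algebra.Properties.Monoid.Sum +-monoid using (sum-cong-≋)
  open import Algebra.Properties.Semiring.Exp semiring using (_^_)
  open import Algebra.Properties.CommutativeSemigroup *-commutativeSemigroup using (x∙yz≈y∙xz)

  ≡⇒≈ : ∀ {a b} → a ≡ b → a ≈ b
  ≡⇒≈ ≡.refl = refl

  Σ : ℕ → (ℕ → Carrier) → Carrier
  Σ = sumTo F

  Σ-cong≤ : ∀ n {f g} → (∀ i → i ≤ n → f i ≈ g i) → Σ n f ≈ Σ n g
  Σ-cong≤ zero    f≈g = f≈g 0 z≤n
  Σ-cong≤ (suc n) f≈g =
    +-cong (Σ-cong≤ n (λ i i≤n → f≈g i (ℕP.m≤n⇒m≤1+n i≤n))) (f≈g (suc n) ℕP.≤-refl)

  Σ-cong : ∀ n {f g} → (∀ i → f i ≈ g i) → Σ n f ≈ Σ n g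
  Σ-cong n f≈g = Σ-cong≤ n (λ i _ → f≈g i)

  Σ-zero : ∀ n {f} → (∀ i → i ≤ n → f i ≈ 0#) → Σ n f ≈ 0#
  Σ-zero n f≈0 = trans (Σ-cong≤ n f≈0) (Σ-0 n)
    where
    Σ-0 : ∀ n → Σ n (λ _ → 0#) ≈ 0#
    Σ-0 zero    = refl
    Σ-0 (suc n) = trans (+-identityʳ _) (Σ-0 n)

  Σ-+ : ∀ n f g → Σ n (λ i → f i + g i) ≈ Σ n f + Σ n g
  Σ-+ zero    f g = refl
  Σ-+ (suc n) f g = begin
    Σ n (λ i → f i + g i) + (f (suc n) + g (suc n)) ≈⟨ +-congʳ (Σ-+ n f g) ⟩
    (Σ n f + Σ n g) + (f (suc n) + g (suc n))       ≈⟨ solve 4 (λ a b x y → (a :+ b) :+ (x :+ y) := (a :+ x) :+ (b :+ y))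
                                                          refl (Σ n f) (Σ n g) (f (suc n)) (g (suc n)) ⟩
    Σ (suc n) f + Σ (suc n) g                        ∎

  Σ-*ˡ : ∀ n a f → a * Σ n f ≈ Σ n (λ i → a * f i)
  Σ-*ˡ zero    a f = refl
  Σ-*ˡ (suc n) a f = trans (distribˡ a _ _) (+-congʳ (Σ-*ˡ n a f))

  Σ-*ʳ : ∀ n a f → Σ n f * a ≈ Σ n (λ i → f i * a)
  Σ-*ʳ n a f = trans (*-comm _ a) (trans (Σ-*ˡ n a f) (Σ-cong n (λ i → *-comm a (f i))))

  Σ-head : ∀ n f → Σ (suc n) f ≈ f 0 + Σ n (λ i → f (suc i))
  Σ-head zero    f = refl
  Σ-head (suc n) f = trans (+-congʳ (Σ-head n f)) (+-assoc _ _ _)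

  Σ-reverse : ∀ n f → Σ n f ≈ Σ n (λ i → f (n ∸ i))
  Σ-reverse zero    f = refl
  Σ-reverse (suc n) f = begin
    Σ n f + f (suc n)                          ≈⟨ +-comm _ _ ⟩
    f (suc n) + Σ n f                          ≈⟨ +-congˡ (Σ-reverse n f) ⟩
    f (suc n) + Σ n (λ i → f (suc n ∸ suc i)) ≈⟨ Σ-head n (λ i → f (suc n ∸ i)) ⟨
    Σ (suc n) (λ i → f (suc n ∸ i))            ∎

  Σ-swap : ∀ n m (g : ℕ → ℕ → Carrier) →
           Σ n (λ i → Σ m (λ j → g i j)) ≈ Σ m (λ j → Σ n (λ i → g i j))
  Σ-swap zero    m g = refl
  Σ-swap (suc n) m g = trans (+-congʳ (Σ-swap n m g)) (sym (Σ-+ m _ _))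

  Σ-triangle : ∀ n (g : ℕ → ℕ → Carrier) →
               Σ n (λ i → Σ i (λ j → g i j)) ≈ Σ n (λ j → Σ (n ∸ j) (λ k → g (j ℕ.+ k) j))
  Σ-triangle zero    g = refl
  Σ-triangle (suc n) g = begin
    Σ n (λ i → Σ i (g i)) + (Σ n (g (suc n)) + g (suc n) (suc n))
      ≈⟨ trans (+-congʳ (Σ-triangle n g)) (sym (+-assoc _ _ _)) ⟩
    (Σ n (λ j → Σ (n ∸ j) (λ k → g (j ℕ.+ k) j)) + Σ n (g (suc n))) + g (suc n) (suc n)
      ≈⟨ +-cong (trans (sym (Σ-+ n _ _)) (Σ-cong≤ n extend)) (≡⇒≈ (≡.cong (λ t → g t (suc n)) (≡.sym (ℕP.+-identityʳ (suc n))))) ⟩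
    Σ n (λ j → Σ (suc n ∸ j) (λ k → g (j ℕ.+ k) j)) + g (suc n ℕ.+ 0) (suc n)
      ≡⟨ ≡.cong (λ t → Σ n (λ j → Σ (suc n ∸ j) (λ k → g (j ℕ.+ k) j)) + Σ t (λ k → g (suc n ℕ.+ k) (suc n)))
                (ℕP.n∸n≡0 n) ⟨
    Σ (suc n) (λ j → Σ (suc n ∸ j) (λ k → g (j ℕ.+ k) j)) ∎
    where
    extend : ∀ j → j ≤ n →
             Σ (n ∸ j) (λ k → g (j ℕ.+ k) j) + g (suc n) j ≈ Σ (suc n ∸ j) (λ k → g (j ℕ.+ k) j)
    extend j j≤n rewrite ℕP.+-∸-assoc 1 j≤n =
      +-congˡ (≡⇒≈ (≡.cong (λ t → g t j)
        (≡.trans (≡.sym (ℕP.m+[n∸m]≡n (ℕP.m≤n⇒m≤1+n j≤n))) (≡.cong (j ℕ.+_) (ℕP.+-∸-assoc 1 j≤n)))))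

  Σ≈sum : ∀ n f → Σ n f ≈ sum {suc n} (λ k → f (toℕ k))
  Σ≈sum zero    f = sym (+-identityʳ _)
  Σ≈sum (suc n) f = trans (Σ-head n f) (+-congˡ (Σ≈sum n (λ i → f (suc i))))

  ofℕ-+ : ∀ m n → ofℕ (m ℕ.+ n) ≈ ofℕ m + ofℕ n
  ofℕ-+ zero    n = sym (+-identityˡ _)
  ofℕ-+ (suc m) n = trans (+-congˡ (ofℕ-+ m n)) (sym (+-assoc _ _ _))

  ofℕ-* : ∀ m n → ofℕ (m ℕ.* n) ≈ ofℕ m * ofℕ n
  ofℕ-* zero    n = sym (zeroˡ _)
  ofℕ-* (suc m) n = begin
    ofℕ (n ℕ.+ m ℕ.* n)        ≈⟨ trans (ofℕ-+ n (m ℕ.* n)) (+-cong (sym (*-identityˡ _)) (ofℕ-* m n)) ⟩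
    1# * ofℕ n + ofℕ m * ofℕ n ≈⟨ distribʳ _ _ _ ⟨
    (1# + ofℕ m) * ofℕ n        ∎

  ofℕ-×-* : ∀ n x → n × x ≈ ofℕ n * x
  ofℕ-×-* zero    x = sym (zeroˡ x)
  ofℕ-×-* (suc n) x = trans (+-cong (sym (*-identityˡ x)) (ofℕ-×-* n x)) (sym (distribʳ _ _ _))

  ofℕ-!-split : ∀ {n m} → m ≤ n → ofℕ (n !) ≈ ofℕ (n C m) * (ofℕ (m !) * ofℕ ((n ∸ m) !))
  ofℕ-!-split {n} {m} m≤n = begin
    ofℕ (n !)                                ≡⟨ ≡.cong ofℕ nCm*m!*[n∸m]!≡n! ⟨
    ofℕ ((n C m) ℕ.* (m ! ℕ.* (n ∸ m) !))  ≈⟨ trans (ofℕ-* (n C m) _) (*-congˡ (ofℕ-* (m !) ((n ∸ m) !))) ⟩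
    ofℕ (n C m) * (ofℕ (m !) * ofℕ ((n ∸ m) !)) ∎
    where
    nCm*m!*[n∸m]!≡n! : (n C m) ℕ.* (m ! ℕ.* (n ∸ m) !) ≡ n !
    nCm*m!*[n∸m]!≡n! = ≡.trans (≡.cong (ℕ._* (m ! ℕ.* (n ∸ m) !)) (nCk≡n!/k![n-k]! m≤n))
                                (m/n*n≡m {{m ℕP.!* (n ∸ m) !≢0}} (k![n∸k]!∣n! m≤n))

  recip-inverse : ∀ m → {{NonZero m}} → recip F m * ofℕ m ≈ 1#
  recip-inverse (suc m) = inv-left _ _

  invFact-inverse : ∀ n → invFact F n * ofℕ (n !) ≈ 1#
  invFact-inverse n = recip-inverse (n !) {{n ℕP.!≢0}}

  invFact-0 : invFact F 0 ≈ 1#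
  invFact-0 = trans (sym (*-identityʳ _)) (trans (*-congˡ (sym (+-identityʳ 1#))) (invFact-inverse 0))

  invFact-binomial : ∀ n i → i ≤ n → invFact F i * invFact F (n ∸ i) * ofℕ (n !) ≈ ofℕ (n C i)
  invFact-binomial n i i≤n = begin
    iF i * iF (n ∸ i) * ofℕ (n !)
      ≈⟨ *-congˡ (ofℕ-!-split i≤n) ⟩
    iF i * iF (n ∸ i) * (ofℕ (n C i) * (ofℕ (i !) * ofℕ ((n ∸ i) !)))
      ≈⟨ solve 5 (λ a b c x y → a :* b :* (c :* (x :* y)) := c :* ((a :* x) :* (b :* y))) refl _ _ _ _ _ ⟩
    ofℕ (n C i) * ((iF i * ofℕ (i !)) * (iF (n ∸ i) * ofℕ ((n ∸ i) !)))
      ≈⟨ *-congˡ (trans (*-cong (invFact-inverse i) (invFact-inverse (n ∸ i))) (*-identityˡ 1#)) ⟩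
    ofℕ (n C i) * 1#
      ≈⟨ *-identityʳ _ ⟩
    ofℕ (n C i) ∎
    where iF = invFact F

  pow≈^ : ∀ x n → pow F x n ≈ x ^ n
  pow≈^ x zero    = refl
  pow≈^ x (suc n) = *-congˡ (pow≈^ x n)

  binomial-theorem : ∀ x y n →
                     pow F (x + y) n ≈ Σ n (λ k → ofℕ (n C k) * (pow F x k * pow F y (n ∸ k)))
  binomial-theorem x y n = begin
    pow F (x + y) n                ≈⟨ pow≈^ _ n ⟩
    (x + y) ^ n                    ≈⟨ theorem n x y ⟩
    binomialExpansion x y n        ≈⟨ sum-cong-≋ {suc n} (λ k → trans (ofℕ-×-* (n C toℕ k) _)
                                        (*-congˡ (*-cong (sym (pow≈^ x (toℕ k))) (sym (pow≈^ y (n ∸ toℕ k)))))) ⟩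
    sum {suc n} (λ k → ofℕ (n C toℕ k) * (pow F x (toℕ k) * pow F y (n ∸ toℕ k)))
                                   ≈⟨ Σ≈sum n _ ⟨
    Σ n (λ k → ofℕ (n C k) * (pow F x k * pow F y (n ∸ k))) ∎
    where
    open Binomial commutativeSemiring using (theorem; binomialExpansion)

  infix  4 _≋_
  infixl 7 _⊛′_
  infixl 6 _⊕′_

  _≋_ : FPS F → FPS F → Set ℓ
  f ≋ g = ∀ n → f n ≈ g n

  _⊛′_ : FPS F → FPS F → FPS F
  _⊛′_ = _⊛_ F

  _⊕′_ : FPS F → FPS F → FPS F
  _⊕′_ = _⊕_ F

  ≋-isEquivalence : IsEquivalence _≋_
  ≋-isEquivalence = record
    { refl  = λ _ → refl
    ; sym   = λ f≋g n → sym (f≋g n)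
    ; trans = λ f≋g g≋h n → trans (f≋g n) (g≋h n)
    }

  open IsEquivalence ≋-isEquivalence
    using () renaming (refl to ≋-refl; sym to ≋-sym; trans to ≋-trans)

  ⊛-cong : ∀ {f f′ g g′} → f ≋ f′ → g ≋ g′ → f ⊛′ g ≋ f′ ⊛′ g′
  ⊛-cong f≋f′ g≋g′ n = Σ-cong n (λ i → *-cong (f≋f′ i) (g≋g′ (n ∸ i)))

  ⊛-comm : ∀ f g → f ⊛′ g ≋ g ⊛′ f
  ⊛-comm f g n = begin
    Σ n (λ i → f i * g (n ∸ i))               ≈⟨ Σ-reverse n _ ⟩
    Σ n (λ i → f (n ∸ i) * g (n ∸ (n ∸ i)))   ≈⟨ Σ-cong≤ n (λ i i≤n → trans (*-comm _ _)
                                                   (*-congʳ (≡⇒≈ (≡.cong g (ℕP.m∸[m∸n]≡n i≤n))))) ⟩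
    Σ n (λ i → g i * f (n ∸ i))               ∎

  ⊛-assoc : ∀ f g h → (f ⊛′ g) ⊛′ h ≋ f ⊛′ (g ⊛′ h)
  ⊛-assoc f g h n = begin
    Σ n (λ i → Σ i (λ j → f j * g (i ∸ j)) * h (n ∸ i))
      ≈⟨ trans (Σ-cong n (λ i → Σ-*ʳ i _ _)) (Σ-triangle n _) ⟩
    Σ n (λ j → Σ (n ∸ j) (λ k → f j * g (j ℕ.+ k ∸ j) * h (n ∸ (j ℕ.+ k))))
      ≈⟨ Σ-cong n (λ j → Σ-cong (n ∸ j) (λ k → trans (*-assoc _ _ _) (*-congˡ (*-cong
           (≡⇒≈ (≡.cong g (ℕP.m+n∸m≡n j k))) (≡⇒≈ (≡.cong h (≡.sym (ℕP.∸-+-assoc n j k)))))))) ⟩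
    Σ n (λ j → Σ (n ∸ j) (λ k → f j * (g k * h (n ∸ j ∸ k))))
      ≈⟨ Σ-cong n (λ j → Σ-*ˡ (n ∸ j) _ _) ⟨
    Σ n (λ j → f j * Σ (n ∸ j) (λ k → g k * h (n ∸ j ∸ k))) ∎

  ⊛-identityˡ : ∀ f → oneS F ⊛′ f ≋ f
  ⊛-identityˡ f zero    = *-identityˡ _
  ⊛-identityˡ f (suc n) = begin
    (oneS F ⊛′ f) (suc n)                         ≈⟨ Σ-head n _ ⟩
    1# * f (suc n) + Σ n (λ i → 0# * f (n ∸ i))  ≈⟨ +-cong (*-identityˡ _) (Σ-zero n (λ i _ → zeroˡ _)) ⟩
    f (suc n) + 0#                                ≈⟨ +-identityʳ _ ⟩
    f (suc n)                                     ∎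

  ⊛-identityʳ : ∀ f → f ⊛′ oneS F ≋ f
  ⊛-identityʳ f n = trans (⊛-comm f (oneS F) n) (⊛-identityˡ f n)

  ⊛-distribˡ : ∀ f g h → f ⊛′ (g ⊕′ h) ≋ f ⊛′ g ⊕′ f ⊛′ h
  ⊛-distribˡ f g h n = trans (Σ-cong n (λ i → distribˡ _ _ _)) (Σ-+ n _ _)

  ⊛-distribʳ : ∀ f g h → (g ⊕′ h) ⊛′ f ≋ g ⊛′ f ⊕′ h ⊛′ f
  ⊛-distribʳ f g h n = trans (Σ-cong n (λ i → distribʳ _ _ _)) (Σ-+ n _ _)

  ⊛-zeroˡ : ∀ f → (λ _ → 0#) ⊛′ f ≋ (λ _ → 0#)
  ⊛-zeroˡ f n = Σ-zero n (λ i _ → zeroˡ _)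

  ⊛-zeroʳ : ∀ f → f ⊛′ (λ _ → 0#) ≋ (λ _ → 0#)
  ⊛-zeroʳ f n = Σ-zero n (λ i _ → zeroʳ _)

  FPS-commutativeSemiring : CommutativeSemiring c ℓ
  FPS-commutativeSemiring = record
    { Carrier = FPS F ; _≈_ = _≋_ ; _+_ = _⊕′_ ; _*_ = _⊛′_ ; 0# = λ _ → 0# ; 1# = oneS F
    ; isCommutativeSemiring = record
      { isSemiring = record
        { isSemiringWithoutAnnihilatingZero = record
          { +-isCommutativeMonoid = record
            { isMonoid = record
              { isSemigroup = record
                { isMagma = record
                  { isEquivalence = ≋-isEquivalence
                  ; ∙-cong        = λ f≋f′ g≋g′ n → +-cong (f≋f′ n) (g≋g′ n)
                  }
                ; assoc = λ f g h n → +-assoc (f n) (g n) (h n)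
                }
              ; identity = (λ f n → +-identityˡ (f n)) , (λ f n → +-identityʳ (f n))
              }
            ; comm = λ f g n → +-comm (f n) (g n)
            }
          ; *-cong     = ⊛-cong
          ; *-assoc    = ⊛-assoc
          ; *-identity = ⊛-identityˡ , ⊛-identityʳ
          ; distrib    = ⊛-distribˡ , ⊛-distribʳ
          }
        ; zero = ⊛-zeroˡ , ⊛-zeroʳ
        }
      ; *-comm = ⊛-comm
      }
    }

  module FPS = CommutativeSemiring FPS-commutativeSemiring
  open import Algebra.Properties.Semiring.Exp FPS.semiring using () renaming (_^_ to _^ₛ_)
  open import Algebra.Definitions.RawMonoid FPS.+-rawMonoid using () renaming (sum to sumₛ; _×_ to _×ₛ_)
  open import Algebra.Properties.CommutativeSemigroup FPS.*-commutativeSemigroup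
    using () renaming (interchange to ⊛-interchange)

  powS≈^ₛ : ∀ f m → powS F f m ≋ f ^ₛ m
  powS≈^ₛ f zero    = ≋-refl
  powS≈^ₛ f (suc m) = ⊛-cong ≋-refl (powS≈^ₛ f m)

  sumₛ-coefficient : ∀ {m} (v : Fin m → FPS F) i → sumₛ v i ≈ sum (λ k → v k i)
  sumₛ-coefficient {zero}  v i = refl
  sumₛ-coefficient {suc m} v i = +-congˡ (sumₛ-coefficient (λ k → v (Fin.suc k)) i)

  ×ₛ-coefficient : ∀ m g i → (m ×ₛ g) i ≈ ofℕ m * g i
  ×ₛ-coefficient m g i = trans (×-coefficient m) (ofℕ-×-* m (g i))
    where
    ×-coefficient : ∀ m → (m ×ₛ g) i ≈ m × g i
    ×-coefficient zero    = refl
    ×-coefficient (suc m) = +-congˡ (×-coefficient m)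

  powS-binomial : ∀ f g s i →
                  powS F (f ⊕′ g) s i ≈ Σ s (λ j → ofℕ (s C j) * (powS F f j ⊛′ powS F g (s ∸ j)) i)
  powS-binomial f g s i = begin
    powS F (f ⊕′ g) s i
      ≈⟨ powS≈^ₛ (f ⊕′ g) s i ⟩
    ((f ⊕′ g) ^ₛ s) i
      ≈⟨ theorem s f g i ⟩
    binomialExpansion f g s i
      ≈⟨ sumₛ-coefficient {suc s} (binomialTerm f g s) i ⟩
    sum {suc s} (λ j → binomialTerm f g s j i)
      ≈⟨ sum-cong-≋ {suc s} (λ j → trans (×ₛ-coefficient (s C toℕ j) ((f ^ₛ toℕ j) ⊛′ (g ^ₛ (s ∸ toℕ j))) i)
           (*-congˡ (⊛-cong (≋-sym (powS≈^ₛ f (toℕ j))) (≋-sym (powS≈^ₛ g (s ∸ toℕ j))) i))) ⟩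
    sum {suc s} (λ j → ofℕ (s C toℕ j) * (powS F f (toℕ j) ⊛′ powS F g (s ∸ toℕ j)) i)
      ≈⟨ Σ≈sum s _ ⟨
    Σ s (λ j → ofℕ (s C j) * (powS F f j ⊛′ powS F g (s ∸ j)) i) ∎
    where open Binomial FPS-commutativeSemiring using (theorem; binomialExpansion; binomialTerm)

  powS-cong : ∀ {f g} m → f ≋ g → powS F f m ≋ powS F g m
  powS-cong zero    f≋g = ≋-refl
  powS-cong (suc m) f≋g = ⊛-cong f≋g (powS-cong m f≋g)

  powS-⊛ : ∀ f g m → powS F (f ⊛′ g) m ≋ powS F f m ⊛′ powS F g m
  powS-⊛ f g zero    = ≋-sym (⊛-identityˡ (oneS F))
  powS-⊛ f g (suc m) = ≋-trans (⊛-cong ≋-refl (powS-⊛ f g m)) (⊛-interchange f g (powS F f m) (powS F g m))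

  powS-oneS : ∀ m → powS F (oneS F) m ≋ oneS F
  powS-oneS zero    = ≋-refl
  powS-oneS (suc m) = ≋-trans (⊛-cong ≋-refl (powS-oneS m)) (⊛-identityˡ (oneS F))

  powS-inverse : ∀ {f g} m → f ⊛′ g ≋ oneS F → powS F f m ⊛′ powS F g m ≋ oneS F
  powS-inverse {f} {g} m fg≋1 =
    ≋-trans (≋-sym (powS-⊛ f g m)) (≋-trans (powS-cong m fg≋1) (powS-oneS m))

  constS-⊛ : ∀ a g → constS F a ⊛′ g ≋ scaleS F a g
  constS-⊛ a g zero    = refl
  constS-⊛ a g (suc n) = begin
    (constS F a ⊛′ g) (suc n)                     ≈⟨ Σ-head n _ ⟩
    a * g (suc n) + Σ n (λ i → 0# * g (n ∸ i))   ≈⟨ +-congˡ (Σ-zero n (λ i _ → zeroˡ _)) ⟩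
    a * g (suc n) + 0#                            ≈⟨ +-identityʳ _ ⟩
    a * g (suc n)                                 ∎

  constS-cong : ∀ {a b} → a ≈ b → constS F a ≋ constS F b
  constS-cong a≈b zero    = a≈b
  constS-cong a≈b (suc n) = refl

  constS-1 : constS F 1# ≋ oneS F
  constS-1 zero    = refl
  constS-1 (suc n) = refl

  constS-* : ∀ a b → constS F a ⊛′ constS F b ≋ constS F (a * b)
  constS-* a b n = trans (constS-⊛ a (constS F b) n) (scale-constS n)
    where
    scale-constS : ∀ n → a * constS F b n ≈ constS F (a * b) n
    scale-constS zero    = refl
    scale-constS (suc n) = zeroʳ a

  constS-pow : ∀ a m → powS F (constS F a) m ≋ constS F (pow F a m)
  constS-pow a zero    = ≋-sym constS-1
  constS-pow a (suc m) = ≋-trans (⊛-cong ≋-refl (constS-pow a m)) (constS-* a _)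

  expS-0 : ∀ a → expS F a 0 ≈ 1#
  expS-0 a = trans (*-identityˡ _) invFact-0

  expS-0# : expS F 0# ≋ oneS F
  expS-0# zero    = expS-0 0#
  expS-0# (suc n) = trans (*-congʳ (zeroˡ _)) (zeroˡ _)

  expS-+ : ∀ a b → expS F a ⊛′ expS F b ≋ expS F (a + b)
  expS-+ a b n = begin
    X                                ≈⟨ *-identityʳ X ⟨
    X * 1#                           ≈⟨ *-congˡ (trans (*-comm _ _) (invFact-inverse n)) ⟨
    X * (ofℕ (n !) * iF n)           ≈⟨ trans (*-congʳ (sym (Σ-*ʳ n _ _))) (*-assoc _ _ _) ⟨
    Σ n (λ i → aᵢbⱼ i * ofℕ (n !)) * iF n
      ≈⟨ *-congʳ (Σ-cong≤ n (λ i i≤n → trans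
           (solve 5 (λ p q u v w → (p :* u) :* (q :* v) :* w := (u :* v :* w) :* (p :* q)) refl _ _ _ _ _)
           (*-congʳ (invFact-binomial n i i≤n)))) ⟩
    Σ n (λ i → ofℕ (n C i) * (pow F a i * pow F b (n ∸ i))) * iF n
      ≈⟨ *-congʳ (binomial-theorem a b n) ⟨
    pow F (a + b) n * iF n ∎
    where
    iF = invFact F
    aᵢbⱼ : ℕ → Carrier
    aᵢbⱼ i = (pow F a i * iF i) * (pow F b (n ∸ i) * iF (n ∸ i))
    X = Σ n aᵢbⱼ

  expS-pow : ∀ m → powS F (expS F 1#) m ≋ expS F (ofℕ m)
  expS-pow zero    = ≋-sym expS-0#
  expS-pow (suc m) = ≋-trans (⊛-cong ≋-refl (expS-pow m)) (expS-+ 1# (ofℕ m))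

  powS-order : ∀ {h} → h 0 ≈ 0# → ∀ m n → n < m → powS F h m n ≈ 0#
  powS-order h₀≈0 (suc m) zero    _         = trans (*-congʳ h₀≈0) (zeroˡ _)
  powS-order {h} h₀≈0 (suc m) (suc n) (s≤s n<m) = begin
    powS F h (suc m) (suc n)
      ≈⟨ Σ-head n _ ⟩
    h 0 * powS F h m (suc n) + Σ n (λ i → h (suc i) * powS F h m (n ∸ i))
      ≈⟨ +-cong (trans (*-congʳ h₀≈0) (zeroˡ _)) (Σ-zero n (λ i i≤n →
           trans (*-congˡ (powS-order h₀≈0 m (n ∸ i) (ℕP.≤-<-trans (ℕP.m∸n≤m n i) n<m))) (zeroʳ _))) ⟩
    0# + 0#
      ≈⟨ +-identityʳ _ ⟩
    0# ∎

  geometric : FPS F → FPS F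
  geometric h n = Σ n (λ m → powS F h m n)

  geometric-extend : ∀ {h} → h 0 ≈ 0# → ∀ N p → p ≤ N → Σ N (λ m → powS F h m p) ≈ geometric h p
  geometric-extend h₀≈0 zero    zero z≤n  = refl
  geometric-extend h₀≈0 (suc N) p  p≤1+N with ℕP.m≤n⇒m<n∨m≡n p≤1+N
  ... | inj₂ ≡.refl = refl
  ... | inj₁ p<1+N  = trans (+-cong (geometric-extend h₀≈0 N p (ℕP.≤-pred p<1+N)) (powS-order h₀≈0 (suc N) p p<1+N))
                            (+-identityʳ _)

  geometric-fixpoint : ∀ {h} → h 0 ≈ 0# → geometric h ≋ oneS F ⊕′ h ⊛′ geometric h
  geometric-fixpoint {h} h₀≈0 n = begin
    geometric h n                                   ≈⟨ geometric-extend h₀≈0 (suc n) n (ℕP.n≤1+n n) ⟨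
    Σ (suc n) (λ m → powS F h m n)                  ≈⟨ Σ-head n _ ⟩
    oneS F n + Σ n (λ m → (h ⊛′ powS F h m) n)      ≈⟨ +-congˡ (Σ-swap n n _) ⟨
    oneS F n + Σ n (λ i → Σ n (λ m → h i * powS F h m (n ∸ i)))
      ≈⟨ +-congˡ (Σ-cong n (λ i → trans (sym (Σ-*ˡ n _ _))
           (*-congˡ (geometric-extend h₀≈0 n (n ∸ i) (ℕP.m∸n≤m n i))))) ⟩
    oneS F n + (h ⊛′ geometric h) n                 ∎

  -- Q = Σ_m h^m satisfies Q = 1 + Q h, and d f = 1 - h, so Q · d f = 1.
  invSWith-inverse : ∀ d f → d * f 0 ≈ 1# → invSWith F d f ⊛′ f ≋ oneS F
  invSWith-inverse d f df₀≈1 n = ∙-cancelʳ ((Q ⊛′ h) n) _ _ (begin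
    (invSWith F d f ⊛′ f) n + (Q ⊛′ h) n
      ≈⟨ +-congʳ (Σ-cong n (λ i → trans (*-congʳ (*-comm _ _)) (*-assoc _ _ _))) ⟩
    (Q ⊛′ scaleS F d f) n + (Q ⊛′ h) n   ≈⟨ ⊛-distribˡ Q (scaleS F d f) h n ⟨
    (Q ⊛′ (scaleS F d f ⊕′ h)) n         ≈⟨ ⊛-cong ≋-refl d·f+h≋1 n ⟩
    (Q ⊛′ oneS F) n                      ≈⟨ ⊛-identityʳ Q n ⟩
    Q n                                   ≈⟨ geometric-fixpoint h₀≈0 n ⟩
    oneS F n + (h ⊛′ Q) n                ≈⟨ +-congˡ (⊛-comm h Q n) ⟩
    oneS F n + (Q ⊛′ h) n                ∎)
    where
    open import Algebra.Properties.Group +-group using (∙-cancelʳ)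
    open import Algebra.Properties.AbelianGroup +-abelianGroup using (xyx⁻¹≈y)
    h : FPS F
    h = _⊖_ F (oneS F) (scaleS F d f)
    Q : FPS F
    Q = geometric h
    h₀≈0 : h 0 ≈ 0#
    h₀≈0 = trans (+-congˡ (-‿cong df₀≈1)) (-‿inverseʳ 1#)
    d·f+h≋1 : scaleS F d f ⊕′ h ≋ oneS F
    d·f+h≋1 i = trans (sym (+-assoc _ _ _)) (xyx⁻¹≈y _ _)

  ⊛-scaleS : ∀ a f g n → (f ⊛′ scaleS F a g) n ≈ a * (f ⊛′ g) n
  ⊛-scaleS a f g n =
    trans (Σ-cong n (λ i → x∙yz≈y∙xz (f i) a _)) (sym (Σ-*ˡ n a _))

  ⊛-Σ : ∀ s (v : ℕ → Carrier) (g : ℕ → FPS F) f n →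
        (f ⊛′ (λ i → Σ s (λ j → v j * g j i))) n ≈ Σ s (λ j → v j * (f ⊛′ g j) n)
  ⊛-Σ s v g f n = begin
    Σ n (λ i → f i * Σ s (λ j → v j * g j (n ∸ i)))     ≈⟨ Σ-cong n (λ i → Σ-*ˡ s _ _) ⟩
    Σ n (λ i → Σ s (λ j → f i * (v j * g j (n ∸ i))))   ≈⟨ Σ-swap n s _ ⟩
    Σ s (λ j → Σ n (λ i → f i * (v j * g j (n ∸ i))))   ≈⟨ Σ-cong s (λ j →
                                                             trans (Σ-cong n (λ i → x∙yz≈y∙xz _ _ _)) (sym (Σ-*ˡ n _ _))) ⟩
    Σ s (λ j → v j * (f ⊛′ g j) n)                       ∎

  egf-convolution : ∀ f g n → ofℕ (n !) * (f ⊛′ g) n ≈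
                    Σ n (λ m → ofℕ (n C m) * (ofℕ (m !) * f m) * (ofℕ ((n ∸ m) !) * g (n ∸ m)))
  egf-convolution f g n = trans (Σ-*ˡ n _ _) (Σ-cong≤ n (λ m m≤n → trans (*-congʳ (ofℕ-!-split m≤n))
    (solve 5 (λ c p q u v → c :* (p :* q) :* (u :* v) := c :* (p :* u) :* (q :* v)) refl _ _ _ _ _)))

  module FrobeniusEuler (s : ℕ) (lam : Carrier) (ne1 : ¬ (lam ≈ 1#)) where

    d : Carrier
    d = inv (1# - lam) (oneMinusNZ F lam ne1)

    e^t-λ : FPS F
    e^t-λ = _⊖_ F (expS F 1#) (constS F lam)

    base : FPS F
    base = scaleS F (1# - lam) (invSWith F d e^t-λ)

    kernel : FPS F
    kernel = powS F base s

    kernel⁻¹ : FPS F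
    kernel⁻¹ = powS F (constS F d ⊛′ e^t-λ) s

    kernel-inverse : kernel ⊛′ kernel⁻¹ ≋ oneS F
    kernel-inverse = powS-inverse s
      (≋-trans (⊛-cong (≋-sym (constS-⊛ (1# - lam) I)) (≋-refl {x = constS F d ⊛′ e^t-λ}))
      (≋-trans (⊛-interchange (constS F (1# - lam)) I (constS F d) e^t-λ)
      (≋-trans (⊛-cong [1-λ]·d≋1 I·[e^t-λ]≋1) (⊛-identityˡ (oneS F)))))
      where
      I : FPS F
      I = invSWith F d e^t-λ
      d·[1-λ]≈1 : d * (1# - lam) ≈ 1#
      d·[1-λ]≈1 = inv-left _ _
      [1-λ]·d≋1 : constS F (1# - lam) ⊛′ constS F d ≋ oneS F
      [1-λ]·d≋1 = ≋-trans (constS-* (1# - lam) d) (≋-trans (constS-cong (trans (*-comm _ _) d·[1-λ]≈1)) constS-1)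
      I·[e^t-λ]≋1 : I ⊛′ e^t-λ ≋ oneS F
      I·[e^t-λ]≋1 = invSWith-inverse d e^t-λ (trans (*-congˡ (+-congʳ (expS-0 1#))) d·[1-λ]≈1)

    kernel-cancel : ∀ G x → (kernel ⊛′ expS F x) ⊛′ (G ⊛′ kernel⁻¹) ≋ G ⊛′ expS F x
    kernel-cancel G x =
      ≋-trans (⊛-cong (⊛-comm kernel (expS F x)) (≋-refl {x = G ⊛′ kernel⁻¹}))
      (≋-trans (⊛-interchange (expS F x) kernel G kernel⁻¹)
      (≋-trans (⊛-cong (⊛-comm (expS F x) G) kernel-inverse) (⊛-identityʳ (G ⊛′ expS F x))))

    binomialWeight : ℕ → Carrier
    binomialWeight j = ofℕ (s C j) * pow F (- lam) (s ∸ j)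

    [e^t-λ]^s-expansion : ∀ i → powS F e^t-λ s i ≈ Σ s (λ j → binomialWeight j * expS F (ofℕ j) i)
    [e^t-λ]^s-expansion i = begin
      powS F e^t-λ s i
        ≈⟨ powS-cong s e^t-λ≋e^t+[-λ] i ⟩
      powS F (expS F 1# ⊕′ constS F (- lam)) s i
        ≈⟨ powS-binomial _ _ s i ⟩
      Σ s (λ j → ofℕ (s C j) * (powS F (expS F 1#) j ⊛′ powS F (constS F (- lam)) (s ∸ j)) i)
        ≈⟨ Σ-cong s term ⟩
      Σ s (λ j → binomialWeight j * expS F (ofℕ j) i) ∎
      where
      e^t-λ≋e^t+[-λ] : e^t-λ ≋ expS F 1# ⊕′ constS F (- lam)
      e^t-λ≋e^t+[-λ] zero    = refl
      e^t-λ≋e^t+[-λ] (suc n) = +-congˡ -0#≈0#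
      term : ∀ j → ofℕ (s C j) * (powS F (expS F 1#) j ⊛′ powS F (constS F (- lam)) (s ∸ j)) i
                   ≈ binomialWeight j * expS F (ofℕ j) i
      term j = trans (*-congˡ (trans (⊛-cong (expS-pow j) (constS-pow (- lam) (s ∸ j)) i)
                                     (trans (⊛-comm (expS F (ofℕ j)) (constS F (pow F (- lam) (s ∸ j))) i)
                                       (constS-⊛ (pow F (- lam) (s ∸ j)) (expS F (ofℕ j)) i))))
                     (sym (*-assoc _ _ _))

    ⊛-kernel⁻¹ : ∀ G n → ofℕ (n !) * (G ⊛′ kernel⁻¹) n ≈
                 pow F d s * Σ s (λ j → binomialWeight j * (ofℕ (n !) * (G ⊛′ expS F (ofℕ j)) n))
    ⊛-kernel⁻¹ G n = begin
      ofℕ (n !) * (G ⊛′ kernel⁻¹) n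
        ≈⟨ *-congˡ (⊛-cong (≋-refl {x = G}) kernel⁻¹-expansion n) ⟩
      ofℕ (n !) * (G ⊛′ scaleS F (pow F d s) P) n
        ≈⟨ *-congˡ (trans (⊛-scaleS (pow F d s) G P n) (*-congˡ (⊛-Σ s binomialWeight (λ j → expS F (ofℕ j)) G n))) ⟩
      ofℕ (n !) * (pow F d s * Σ s (λ j → binomialWeight j * (G ⊛′ expS F (ofℕ j)) n))
        ≈⟨ trans (x∙yz≈y∙xz _ _ _) (*-congˡ (trans (Σ-*ˡ s _ _) (Σ-cong s (λ j → x∙yz≈y∙xz _ _ _)))) ⟩
      pow F d s * Σ s (λ j → binomialWeight j * (ofℕ (n !) * (G ⊛′ expS F (ofℕ j)) n)) ∎
      where
      P : FPS F
      P i = Σ s (λ j → binomialWeight j * expS F (ofℕ j) i)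
      kernel⁻¹-expansion : kernel⁻¹ ≋ scaleS F (pow F d s) P
      kernel⁻¹-expansion =
        ≋-trans (powS-⊛ (constS F d) e^t-λ s)
        (≋-trans (⊛-cong (constS-pow d s) (≋-refl {x = powS F e^t-λ s}))
        (≋-trans (constS-⊛ (pow F d s) (powS F e^t-λ s)) (λ i → *-congˡ ([e^t-λ]^s-expansion i))))

theorem8 : {c ℓ : Level} (F : CharZeroField c ℓ) →
    let open CharZeroField F in
    (r : ℕ) → 1 ≤ r → (s : ℕ) (k : ℤ) (a : Fin r → Carrier) (nz : ∀ i → ¬ (a i ≈ 0#)) →
    (lam : Carrier) (ne1 : ¬ (lam ≈ 1#)) (n : ℕ) (x : Carrier) →
    S F r k a nz n x ≈
      sumTo F n (λ m →
        (ofℕ (n C m) * pow F (inv (1# - lam) (oneMinusNZ F lam ne1)) s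
          * sumTo F s (λ j → ofℕ (s C j) * pow F (- lam) (s ∸ j) * S F r k a nz (n ∸ m) (ofℕ j)))
        * H F s lam ne1 m x)
theorem8 F r _ s k a nz lam ne1 n x = begin
  S F r k a nz n x
    ≈⟨ *-congˡ (kernel-cancel G x n) ⟨
  ofℕ (n !) * ((kernel ⊛′ expS F x) ⊛′ (G ⊛′ kernel⁻¹)) n
    ≈⟨ egf-convolution (kernel ⊛′ expS F x) (G ⊛′ kernel⁻¹) n ⟩
  Σ n (λ m → ofℕ (n C m) * H F s lam ne1 m x * (ofℕ ((n ∸ m) !) * (G ⊛′ kernel⁻¹) (n ∸ m)))
    ≈⟨ Σ-cong n (λ m → trans (*-congˡ (⊛-kernel⁻¹ G (n ∸ m)))
         (solve 4 (λ c h p y → c :* h :* (p :* y) := c :* p :* y :* h) refl _ _ _ _)) ⟩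
  Σ n (λ m → (ofℕ (n C m) * pow F d s
                * Σ s (λ j → binomialWeight j * S F r k a nz (n ∸ m) (ofℕ j)))
             * H F s lam ne1 m x) ∎
  where
  open FormalPowerSeries F
  open FrobeniusEuler s lam ne1
  open CharZeroField F
  open import Relation.Binary.Reasoning.Setoid setoid
  open RingSolver commutativeSemiring using (solve; _:*_; _:=_)
  G : FPS F
  G = prodInv F r a nz ⊛′ LiOverS F k
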